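{- If $T\le U$ are types, then for every pattern valuation $\theta$ with $\mathcal{FV}(T)\cup\mathcal{FV}(U)\subseteq\mathrm{dom}(\theta)$, $[\![T]\!]_\theta\subseteq[\![U]\!]_\theta$.
   Context: Patterns $p::=\alpha\mid\mathsf{leaf}\mid\mathsf{node}(p,q)\mid\_\mid\bot$ ($\alpha$ pattern variables; closed = no variables). Types $T::=\mathbf B(p)\mid T\to U\mid\forall\alpha.T$. Order on patterns $\ll$: generated by $p\ll\_$, $\alpha\ll\alpha$, $\mathsf{leaf}\ll\mathsf{leaf}$, $p_1\ll q_1\wedge p_2\ll q_2\Rightarrow\mathsf{node}(p_1,p_2)\ll\mathsf{node}(q_1,q_2)$, $\bot\ll p$. Subtyping $\le$: $p\ll q\Rightarrow\mathbf B(p)\le\mathbf B(q)$; $T_2\le T_1\wedge U_1\le U_2\Rightarrow T_1\to U_1\le T_2\to U_2$; $T\le U\Rightarrow\forall\alpha.T\le\forall\alpha.U$. Erased terms $t::=x\mid f\mid\lambda x.t\mid t\,u\mid\mathsf{Leaf}\mid\mathsf{Node}$. Fix a finite set of rewrite rules; $\to$ is the closure under contexts of $\beta$-reduction and (erased) rule instances; $\mathcal{SN}$ = strongly normalizing erased terms. Neutral = not of the form $\lambda x.t$, $\mathsf{Node}\,t\,u$, $\mathsf{Leaf}$; a value of $t$ is a non-neutral $v$ with $t\to^*v$. For normal forms $v$ and closed patterns $p$: $v\downarrow p$ iff $p=\_$, or $v$ neutral, or $v=\mathsf{Node}\,v_1v_2$, $p=\mathsf{node}(p_1,p_2)$, $v_i\downarrow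 p_i$, or $v=\mathsf{Leaf}$, $p=\mathsf{leaf}$. A pattern valuation $\theta$ is a partial finite-support map from pattern variables to non-empty sets of closed patterns; $p\theta$: $\alpha\theta=\theta(\alpha)$, $\mathsf{leaf}\theta=\{\mathsf{leaf}\}$, $\_\theta=\{\_\}$, $\bot\theta=\{\bot\}$, $\mathsf{node}(p_1,p_2)\theta=\{\mathsf{node}(q_1,q_2)\mid q_i\in p_i\theta\}$; $\theta[\alpha\mapsto P]$ updates $\theta$ at $\alpha$. For $t\in\mathcal{SN}$, $t\downarrow p\theta$ iff each normal form $v$ of $t$ has some $q\in p\theta$ with $v\downarrow q$. $\mathcal B$ is the smallest set with $\mathcal B=\{t\in\mathcal{SN}\mid$ every value of $t$ is $\mathsf{Leaf}$ or $\mathsf{Node}\,t_1t_2$ with $t_1,t_2\in\mathcal B\}$. $[\![\mathbf B(p)]\!]_\theta=\{t\in\mathcal B\mid t\downarrow p\theta\}$; $[\![T\to U]\!]_\theta=\{t\in\mathcal{SN}\mid\forall u\in[\![T]\!]_\theta,\ t\,u\in[\![U]\!]_\theta\}$; $[\![\forall\beta.T]\!]_\theta=\{t\in\mathcal{SN}\mid\forall P$ non-empty set of closed patterns, $t\in[\![T]\!]_{\theta[\beta\mapsto P]}\}$. -}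

module Defs where

open import Data.Nat using (ℕ; zero; suc)
import Data.Nat
import Relation.Nullary
open import Level using (Lift)
import Level
open import Data.List using (List; []; _∷_)
open import Data.List.Membership.Propositional using (_∈_)
open import Data.List.Relation.Unary.Any using (Any)
open import Data.Product using (Σ; ∃; ∃₂; _×_; _,_; proj₁)
open import Data.Sum using (_⊎_)
open import Data.Empty using (⊥)
open import Relation.Nullary using (¬_)
open import Relation.Binary.PropositionalEquality using (_≡_)
open import Relation.Binary.Construct.Closure.ReflexiveTransitive using (Star)

data Pat : Set where
  pvar : ℕ → Pat
  leaf : Pat
  node : Pat → Pat → Pat
  any  : Pat
  bot  : Pat

data CPat : Set where
  cleaf : CPat
  cnode : CPat → CPat → CPat
  cany  : CPat
  cbot  : CPat

data Ty : Set where
  𝔹    : Pat → Ty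
  _⇒_  : Ty → Ty → Ty
  ∀'   : ℕ → Ty → Ty

infixr 5 _⇒_

data FVPat (α : ℕ) : Pat → Set where
  fv-var   : FVPat α (pvar α)
  fv-nodeˡ : ∀ {p q} → FVPat α p → FVPat α (node p q)
  fv-nodeʳ : ∀ {p q} → FVPat α q → FVPat α (node p q)

data FV (α : ℕ) : Ty → Set where
  fv-𝔹   : ∀ {p} → FVPat α p → FV α (𝔹 p)
  fv-⇒ˡ  : ∀ {T U} → FV α T → FV α (T ⇒ U)
  fv-⇒ʳ  : ∀ {T U} → FV α U → FV α (T ⇒ U)
  fv-∀   : ∀ {β T} → ¬ (α ≡ β) → FV α T → FV α (∀' β T)

data _≪_ : Pat → Pat → Set where
  ≪-any  : ∀ {p} → p ≪ any
  ≪-var  : ∀ {α} → pvar α ≪ pvar α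
  ≪-leaf : leaf ≪ leaf
  ≪-node : ∀ {p₁ p₂ q₁ q₂} → p₁ ≪ q₁ → p₂ ≪ q₂ → node p₁ p₂ ≪ node q₁ q₂
  ≪-bot  : ∀ {p} → bot ≪ p

data _≤T_ : Ty → Ty → Set where
  ≤-𝔹 : ∀ {p q} → p ≪ q → 𝔹 p ≤T 𝔹 q
  ≤-⇒ : ∀ {T₁ T₂ U₁ U₂} → T₂ ≤T T₁ → U₁ ≤T U₂ → (T₁ ⇒ U₁) ≤T (T₂ ⇒ U₂)
  ≤-∀ : ∀ {α T U} → T ≤T U → ∀' α T ≤T ∀' α U

-- Erased terms (de Bruijn indices for term variables; function symbols named by ℕ)

data Tm : Set where
  var  : ℕ → Tm
  fun  : ℕ → Tm
  lam  : Tm → Tm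
  app  : Tm → Tm → Tm
  Leaf : Tm
  Node : Tm

ext : (ℕ → ℕ) → ℕ → ℕ
ext ρ zero    = zero
ext ρ (suc n) = suc (ρ n)

ren : (ℕ → ℕ) → Tm → Tm
ren ρ (var n)   = var (ρ n)
ren ρ (fun f)   = fun f
ren ρ (lam t)   = lam (ren (ext ρ) t)
ren ρ (app t u) = app (ren ρ t) (ren ρ u)
ren ρ Leaf      = Leaf
ren ρ Node      = Node

exts : (ℕ → Tm) → ℕ → Tm
exts σ zero    = var zero
exts σ (suc n) = ren suc (σ n)

sub : (ℕ → Tm) → Tm → Tm
sub σ (var n)   = σ n
sub σ (fun f)   = fun f
sub σ (lam t)   = lam (sub (exts σ) t)
sub σ (app t u) = app (sub σ t) (sub σ u)
sub σ Leaf      = Leaf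
sub σ Node      = Node

sub₀ : Tm → ℕ → Tm
sub₀ u zero    = u
sub₀ u (suc n) = var n

Rules : Set
Rules = List (Tm × Tm)

data Step (R : Rules) : Tm → Tm → Set where
  beta  : ∀ {t u} → Step R (app (lam t) u) (sub (sub₀ u) t)
  rule  : ∀ {l r} → (l , r) ∈ R → (σ : ℕ → Tm) → Step R (sub σ l) (sub σ r)
  ξ-lam : ∀ {t t'} → Step R t t' → Step R (lam t) (lam t')
  ξ-appˡ : ∀ {t t' u} → Step R t t' → Step R (app t u) (app t' u)
  ξ-appʳ : ∀ {t u u'} → Step R u u' → Step R (app t u) (app t u')

Steps : Rules → Tm → Tm → Set
Steps R = Star (Step R)

data SN (R : Rules) (t : Tm) : Set where
  sn : (∀ u → Step R t u → SN R u) → SN R t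

Normal : Rules → Tm → Set
Normal R t = ∀ u → ¬ Step R t u

data NonNeutral : Tm → Set where
  nn-lam  : ∀ {t} → NonNeutral (lam t)
  nn-node : ∀ {t u} → NonNeutral (app (app Node t) u)
  nn-leaf : NonNeutral Leaf

Neutral : Tm → Set
Neutral t = ¬ NonNeutral t

IsValue : Rules → Tm → Tm → Set
IsValue R t v = Steps R t v × NonNeutral v

data _↓_ : Tm → CPat → Set where
  ↓-any  : ∀ {v} → v ↓ cany
  ↓-neu  : ∀ {v p} → Neutral v → v ↓ p
  ↓-node : ∀ {v₁ v₂ p₁ p₂} → v₁ ↓ p₁ → v₂ ↓ p₂ → app (app Node v₁) v₂ ↓ cnode p₁ p₂
  ↓-leaf : Leaf ↓ cleaf

-- Pattern valuations: finite lists of bindings α ↦ P (P a non-empty set of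
-- closed patterns); lookup finds the most recent binding.

NESet : Set₁
NESet = Σ (CPat → Set) (λ P → ∃ P)

Valuation : Set₁
Valuation = List (ℕ × NESet)

InDom : ℕ → Valuation → Set₁
InDom α θ = Any (λ b → proj₁ b ≡ α) θ

-- membership q ∈ θ(α); empty if α ∉ dom θ (never used under the theorem's hypothesis)
memVar : Valuation → ℕ → CPat → Set
memVar [] α q = ⊥
memVar ((β , P , _) ∷ θ) α q with β Data.Nat.≟ α
... | Relation.Nullary.yes _ = P q
... | Relation.Nullary.no  _ = memVar θ α q

_∈⟨_⟩_ : CPat → Pat → Valuation → Set
q ∈⟨ pvar α ⟩ θ     = memVar θ α q
q ∈⟨ leaf ⟩ θ       = q ≡ cleaf
q ∈⟨ node p₁ p₂ ⟩ θ = ∃₂ λ q₁ q₂ → q ≡ cnode q₁ q₂ × q₁ ∈⟨ p₁ ⟩ θ × q₂ ∈⟨ p₂ ⟩ θ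
q ∈⟨ any ⟩ θ        = q ≡ cany
q ∈⟨ bot ⟩ θ        = q ≡ cbot

Down : Rules → Tm → Pat → Valuation → Set
Down R t p θ = ∀ v → Steps R t v → Normal R v → ∃ λ q → q ∈⟨ p ⟩ θ × v ↓ q

-- the set 𝓑, as an inductive (least) predicate
data 𝓑 (R : Rules) (t : Tm) : Set where
  mk𝓑 : SN R t
      → (∀ v → IsValue R t v →
           v ≡ Leaf ⊎ ∃₂ λ t₁ t₂ → v ≡ app (app Node t₁) t₂ × 𝓑 R t₁ × 𝓑 R t₂)
      → 𝓑 R t

⟦_⟧ : Ty → Rules → Valuation → Tm → Set₁
⟦ 𝔹 p ⟧ R θ t    = Lift (Level.suc Level.zero) (𝓑 R t × Down R t p θ)
⟦ T ⇒ U ⟧ R θ t  = Lift (Level.suc Level.zero) (SN R t) × (∀ u → ⟦ T ⟧ R θ u → ⟦ U ⟧ R θ (app t u))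
⟦ ∀' β T ⟧ R θ t = Lift (Level.suc Level.zero) (SN R t) × ((P : NESet) → ⟦ T ⟧ R ((β , P) ∷ θ) t)

-- Induction on the subtyping derivation; only the base case has content. If p ≪ q, every
-- closed instance of p is refined by one of q, or else the matched value is neutral, in which
-- case any instance of q will do, and there is one because q's variables are in dom θ.
module Submission where

open import Defs
open import Data.Sum using (_⊎_; inj₁; inj₂)
open import Data.Nat using (ℕ; _≟_)
open import Data.Product using (∃; _×_; _,_)
open import Data.List using (_∷_)
open import Data.List.Relation.Unary.Any using (here; there)
open import Relation.Nullary using (yes; no; contradiction)
open import Relation.Binary.PropositionalEquality using (refl; sym)
open import Function using (_∘_)
open import Level using (lift)

_⊆dom_ : (ℕ → Set) → Valuation → Set₁
X ⊆dom θ = ∀ {α} → X α → InDom α θ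

memVar-nonempty : ∀ {θ α} → InDom α θ → ∃ (memVar θ α)
memVar-nonempty {(β , _ , P-nonempty) ∷ θ} {α} α∈dom with β ≟ α | α∈dom
... | yes _  | _         = P-nonempty
... | no β≢α | here β≡α  = contradiction β≡α β≢α
... | no _   | there α∈θ = memVar-nonempty α∈θ

instance-nonempty : ∀ {θ} p → (λ α → FVPat α p) ⊆dom θ → ∃ λ q → q ∈⟨ p ⟩ θ
instance-nonempty (pvar α)   fv⊆θ = memVar-nonempty (fv⊆θ fv-var)
instance-nonempty leaf       fv⊆θ = cleaf , refl
instance-nonempty (node p q) fv⊆θ
  with instance-nonempty p (fv⊆θ ∘ fv-nodeˡ) | instance-nonempty q (fv⊆θ ∘ fv-nodeʳ)
... | q₁ , m₁ | q₂ , m₂ = cnode q₁ q₂ , q₁ , q₂ , refl , m₁ , m₂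
instance-nonempty any        fv⊆θ = cany , refl
instance-nonempty bot        fv⊆θ = cbot , refl

≪-match : ∀ {θ p q r v} → p ≪ q → (λ α → FVPat α q) ⊆dom θ →
  r ∈⟨ p ⟩ θ → v ↓ r → ∃ λ r' → r' ∈⟨ q ⟩ θ × v ↓ r'
≪-match {q = q} _ fv⊆θ _ (↓-neu v-neutral)
  with instance-nonempty q fv⊆θ
... | r' , r'∈q = r' , r'∈q , ↓-neu v-neutral
≪-match ≪-any  _ _ _ = cany , refl , ↓-any
≪-match ≪-var  _ r∈p v↓r = _ , r∈p , v↓r
≪-match ≪-leaf _ r∈p v↓r = _ , r∈p , v↓r
≪-match (≪-node p₁≪q₁ p₂≪q₂) fv⊆θ (_ , _ , refl , r₁∈p₁ , r₂∈p₂) (↓-node v₁↓r₁ v₂↓r₂)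
  with ≪-match p₁≪q₁ (fv⊆θ ∘ fv-nodeˡ) r₁∈p₁ v₁↓r₁ | ≪-match p₂≪q₂ (fv⊆θ ∘ fv-nodeʳ) r₂∈p₂ v₂↓r₂
... | r₁' , r₁'∈q₁ , v₁↓r₁' | r₂' , r₂'∈q₂ , v₂↓r₂' =
  cnode r₁' r₂' , (r₁' , r₂' , refl , r₁'∈q₁ , r₂'∈q₂) , ↓-node v₁↓r₁' v₂↓r₂'

Down-mono : ∀ {R t p q θ} → p ≪ q → (λ α → FVPat α q) ⊆dom θ → Down R t p θ → Down R t q θ
Down-mono p≪q fv⊆θ t↓p v t→v v-normal with t↓p v t→v v-normal
... | r , r∈p , v↓r = ≪-match p≪q fv⊆θ r∈p v↓r

FV-∀⊆dom-∷ : ∀ {β T θ} P → (λ α → FV α (∀' β T)) ⊆dom θ → (λ α → FV α T) ⊆dom ((β , P) ∷ θ)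
FV-∀⊆dom-∷ {β} _ fv⊆θ {α} α∈T with β ≟ α
... | yes β≡α = here β≡α
... | no β≢α  = there (fv⊆θ (fv-∀ (β≢α ∘ sym) α∈T))

⟦⟧-mono : ∀ {R T U θ} → T ≤T U →
  (λ α → FV α T) ⊆dom θ → (λ α → FV α U) ⊆dom θ → ∀ t → ⟦ T ⟧ R θ t → ⟦ U ⟧ R θ t
⟦⟧-mono (≤-𝔹 p≪q) _ fvU⊆θ t (lift (t∈𝓑 , t↓p)) =
  lift (t∈𝓑 , Down-mono p≪q (fvU⊆θ ∘ fv-𝔹) t↓p)
⟦⟧-mono (≤-⇒ T₂≤T₁ U₁≤U₂) fvT⊆θ fvU⊆θ t (t-sn , t∈T₁⇒U₁) =
  t-sn , λ u u∈T₂ →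
    ⟦⟧-mono U₁≤U₂ (fvT⊆θ ∘ fv-⇒ʳ) (fvU⊆θ ∘ fv-⇒ʳ) (app t u)
      (t∈T₁⇒U₁ u (⟦⟧-mono T₂≤T₁ (fvU⊆θ ∘ fv-⇒ˡ) (fvT⊆θ ∘ fv-⇒ˡ) u u∈T₂))
⟦⟧-mono (≤-∀ T≤U) fvT⊆θ fvU⊆θ t (t-sn , t∈∀T) =
  t-sn , λ P → ⟦⟧-mono T≤U (FV-∀⊆dom-∷ P fvT⊆θ) (FV-∀⊆dom-∷ P fvU⊆θ) t (t∈∀T P)

mainTheorem7 : (R : Rules) (T U : Ty) → T ≤T U →
    (θ : Valuation) → (∀ α → FV α T ⊎ FV α U → InDom α θ) →
    ∀ t → ⟦ T ⟧ R θ t → ⟦ U ⟧ R θ t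
mainTheorem7 R T U T≤U θ fv⊆θ = ⟦⟧-mono T≤U (fv⊆θ _ ∘ inj₁) (fv⊆θ _ ∘ inj₂)
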